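{- Let $\Gamma$ and $\Delta$ be maximal $\mathbf{IL W^*}$-consistent sets with $\Gamma\prec_C\Delta$, let $P\rhd Q,S_1\rhd T_1,\ldots,S_n\rhd T_n\in\Gamma$, and suppose $\Diamond P\in\Delta$. Then there exist $k\leq n$ and maximal $\mathbf{IL W^*}$-consistent sets $\Delta_0,\ldots,\Delta_k$ such that: $\Gamma\prec_C\Delta_i$ for each $i\le k$; $\Delta\subseteq_\Box\Delta_i$ for each $i\le k$; $Q\in\Delta_0$; $\Box\neg P\in\Delta_i$ for each $i\le k$; and for all $1\leq j\leq n$ and all $h\leq k$, if $S_j\in\Delta_h$ then $T_j\in\Delta_i$ for some $i\leq k$.
   Context: $\mathbf{IL}$ is the interpretability logic in the language with $\bot,\rightarrow,\Box,\rhd$ ($\Diamond=\neg\Box\neg$), axiomatized by tautologies, $\Box(A\rightarrow B)\rightarrow(\Box A\rightarrow\Box B)$, $\Box A\rightarrow\Box\Box A$, $\Box(\Box A\rightarrow A)\rightarrow\Box A$, $\Box(A\rightarrow B)\rightarrow A\rhd B$, $(A\rhd B)\wedge(B\rhd C)\rightarrow A\rhd C$, $(A\rhd C)\wedge(B\rhd C)\rightarrow A\vee B\rhd C$, $A\rhd B\rightarrow(\Diamond A\rightarrow\Diamond B)$, $\Diamond A\rhd A$, with modus ponens and necessitation. $\mathbf{IL W^*}$ adds all instances of $A\rhd B\rightarrow B\wedge\Box C\rhd B\wedge\Box C\wedge\Box\neg A$. For maximal consistent sets: $\Gamma\prec_C\Delta$ iff for all $E$, $E\rhd C\in\Gamma$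 implies $\neg E,\Box\neg E\in\Delta$; $\Delta\subseteq_\Box\Delta'$ iff $\Box E\in\Delta$ implies $\Box E\in\Delta'$. -}

module Defs where

open import Level using (0ℓ)
open import Data.Nat using (ℕ)
open import Data.Bool using (Bool; true; false; not; _∨_)
open import Data.List using (List; []; _∷_)
open import Data.List.Relation.Unary.All using (All)
open import Data.Product using (Σ; _×_)
open import Relation.Binary.PropositionalEquality using (_≡_)
open import Relation.Nullary using (¬_)

infixr 6 _⇒_
infix 7 _▷_

data Fm : Set where
  var : ℕ → Fm
  ⊥'  : Fm
  _⇒_ : Fm → Fm → Fm
  □   : Fm → Fm
  _▷_ : Fm → Fm → Fm

~_ : Fm → Fm
~ A = A ⇒ ⊥'

⊤' : Fm
⊤' = ~ ⊥'

_∨'_ : Fm → Fm → Fm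
A ∨' B = (~ A) ⇒ B

_∧'_ : Fm → Fm → Fm
A ∧' B = ~ (A ⇒ ~ B)

◇ : Fm → Fm
◇ A = ~ (□ (~ A))

-- Propositional tautologies: true under every Boolean valuation of the
-- propositionally atomic subformulas (variables, □A, A ▷ B).
eval : (Fm → Bool) → Fm → Bool
eval v (var p) = v (var p)
eval v ⊥' = false
eval v (A ⇒ B) = not (eval v A) ∨ eval v B
eval v (□ A) = v (□ A)
eval v (A ▷ B) = v (A ▷ B)

Tautology : Fm → Set
Tautology A = (v : Fm → Bool) → eval v A ≡ true

data ILW*⊢_ : Fm → Set where
  taut  : ∀ {A} → Tautology A → ILW*⊢ A
  K     : ∀ {A B} → ILW*⊢ (□ (A ⇒ B) ⇒ (□ A ⇒ □ B))
  four  : ∀ {A} → ILW*⊢ (□ A ⇒ □ (□ A))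
  L     : ∀ {A} → ILW*⊢ (□ (□ A ⇒ A) ⇒ □ A)
  J1    : ∀ {A B} → ILW*⊢ (□ (A ⇒ B) ⇒ (A ▷ B))
  J2    : ∀ {A B C} → ILW*⊢ (((A ▷ B) ∧' (B ▷ C)) ⇒ (A ▷ C))
  J3    : ∀ {A B C} → ILW*⊢ (((A ▷ C) ∧' (B ▷ C)) ⇒ ((A ∨' B) ▷ C))
  J4    : ∀ {A B} → ILW*⊢ ((A ▷ B) ⇒ (◇ A ⇒ ◇ B))
  J5    : ∀ {A} → ILW*⊢ (◇ A ▷ A)
  W*    : ∀ {A B C} →
          ILW*⊢ ((A ▷ B) ⇒ ((B ∧' □ C) ▷ ((B ∧' □ C) ∧' □ (~ A))))
  mp    : ∀ {A B} → ILW*⊢ (A ⇒ B) → ILW*⊢ A → ILW*⊢ B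
  nec   : ∀ {A} → ILW*⊢ A → ILW*⊢ □ A

FmSet : Set₁
FmSet = Fm → Set

_⊆_ : FmSet → FmSet → Set
X ⊆ Y = ∀ A → X A → Y A

⋀ : List Fm → Fm
⋀ [] = ⊤'
⋀ (A ∷ As) = A ∧' ⋀ As

Consistent : FmSet → Set
Consistent X = ¬ (Σ (List Fm) λ As → All X As × ILW*⊢ (⋀ As ⇒ ⊥'))

MaxCons : FmSet → Set₁
MaxCons X = Consistent X × ((Y : FmSet) → X ⊆ Y → Consistent Y → Y ⊆ X)

_≺[_]_ : FmSet → Fm → FmSet → Set
Γ ≺[ C ] Δ = ∀ E → Γ (E ▷ C) → Δ (~ E) × Δ (□ (~ E))

_⊆□_ : FmSet → FmSet → Set
Δ ⊆□ Δ' = ∀ E → Δ (□ E) → Δ' (□ E)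

-- Call F blocked if F ∧ □D ∧ □¬P ▷ C ∈ Γ for some □D ∈ Δ. An unblocked F lies in a maximal
-- consistent Θ with Γ ≺_C Θ, Δ ⊆□ Θ and □¬P ∈ Θ: the set generated by F, □¬P, the boxed
-- formulas of Δ and ¬G, □¬G for G ▷ C ∈ Γ is consistent, for otherwise
-- F ∧ □D ∧ □¬P ▷ G ∨ ◇G ▷ G ▷ C by J5. Blocked formulas are closed under ∨, and by W* no W with
-- P ▷ W ∈ Γ is blocked, because ◇P ∈ Δ. Now add indices j to a list R as long as
-- T_j ∧ ⋀_{i∈R} ¬S_i is blocked. The pieces discarded on the way form a blocked disjunction V
-- with S_j ▷ V for j ∈ R, so P ▷ Q ▷ (Q ∧ ⋀_R ¬S) ∨ V shows that Q ∧ ⋀_R ¬S is unblocked, as is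
-- T_j ∧ ⋀_R ¬S for every j ∉ R once R is saturated. Extensions of these formulas form the
-- family: S_j in a member forces j ∉ R, and then T_j has a member of its own.

module Submission where

open import Defs
open import Level using (0ℓ)
open import Axiom.ExcludedMiddle using (ExcludedMiddle)
open import Data.Nat using (ℕ; _≤_; suc)
open import Data.Fin using (Fin; zero)
open import Data.Product using (Σ; ∃; _×_)

open import Data.Bool using (Bool; true; false; not; _∨_)
open import Data.Bool.Properties using (_≟_)
open import Data.Empty using (⊥; ⊥-elim)
open import Data.Fin using (suc)
open import Data.List using (List; []; _∷_; _++_; map; cartesianProductWith)
open import Data.List.Membership.Propositional using (_∈_; _∉_)
open import Data.List.Membership.Propositional.Properties
  using (∈-++⁺ˡ; ∈-++⁺ʳ; ∈-map⁺; ∈-cartesianProductWith⁺)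
open import Data.List.Relation.Unary.All as All using (All; []; _∷_)
open import Data.List.Relation.Unary.All.Properties using (++⁺; ++⁻ˡ; ++⁻ʳ; map⁻)
open import Data.List.Relation.Unary.Any using (here; there)
open import Data.Nat using (zero; _⊔_; _≤′_; ≤′-refl; ≤′-step)
open import Data.Nat.Properties using (≤-refl; m≤m⊔n; m≤n⊔m; ≤⇒≤′)
open import Data.Product using (_,_; proj₁; proj₂)
open import Data.Sum using (_⊎_; inj₁; inj₂; [_,_]′)
open import Data.Vec using (Vec; allFin) renaming ([] to []ᵥ; _∷_ to _∷ᵥ_)
import Data.Vec.Relation.Unary.Any as Vec
open import Data.Vec.Membership.Propositional using () renaming (_∈_ to _∈ᵥ_)
open import Data.Vec.Membership.Propositional.Properties using (∈-allFin⁺)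
open import Function using (_∘_; const)
open import Relation.Binary.PropositionalEquality using (_≡_; refl; subst)
open import Relation.Nullary using (¬_; Dec; yes; no)
open import Relation.Nullary.Decidable using (map′)

private variable
  A B D F G W : Fm
  As Bs Ts : List Fm
  X Y : FmSet

∈ᵥ-remove : ∀ {I : Set} {k} {x : I} {xs : Vec I (suc k)} → x ∈ᵥ xs →
            Σ (Vec I k) λ ys → ∀ {y} → y ∈ᵥ xs → y ≡ x ⊎ y ∈ᵥ ys
∈ᵥ-remove {xs = _ ∷ᵥ xs} (Vec.here refl) = xs , λ { (Vec.here e) → inj₁ e ; (Vec.there p) → inj₂ p }
∈ᵥ-remove {xs = _ ∷ᵥ []ᵥ} (Vec.there ())
∈ᵥ-remove {xs = y ∷ᵥ _ ∷ᵥ _} (Vec.there p) with ∈ᵥ-remove p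
... | ys , split = y ∷ᵥ ys , λ { (Vec.here e) → inj₂ (Vec.here e)
                              ; (Vec.there q) → [ inj₁ , inj₂ ∘ Vec.there ]′ (split q) }

-- A record rather than eval v A ≡ true, so that A can be recovered by unification.
record Holds (v : Fm → Bool) (A : Fm) : Set where
  constructor ⟨_⟩
  field holds : eval v A ≡ true
open Holds

not-∨-intro : ∀ a b → (a ≡ true → b ≡ true) → not a ∨ b ≡ true
not-∨-intro false b f = refl
not-∨-intro true  b f = f refl

not-∨-elim : ∀ a b → not a ∨ b ≡ true → a ≡ true → b ≡ true
not-∨-elim true b h refl = h

module _ {v : Fm → Bool} where

  holds? : ∀ A → Dec (Holds v A)
  holds? A = map′ ⟨_⟩ holds (eval v A ≟ true)

  ⇒I : (Holds v A → Holds v B) → Holds v (A ⇒ B)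
  ⇒I {A} {B} f = ⟨ not-∨-intro (eval v A) (eval v B) (holds ∘ f ∘ ⟨_⟩) ⟩

  ⇒E : Holds v (A ⇒ B) → Holds v A → Holds v B
  ⇒E {A} {B} h a = ⟨ not-∨-elim (eval v A) (eval v B) (holds h) (holds a) ⟩

  ⊥E : ¬ Holds v ⊥'
  ⊥E ⟨ () ⟩

  ~I : ¬ Holds v A → Holds v (~ A)
  ~I f = ⇒I (⊥-elim ∘ f)

  ~E : Holds v (~ A) → ¬ Holds v A
  ~E h = ⊥E ∘ ⇒E h

  ⊤I : Holds v ⊤'
  ⊤I = ~I ⊥E

  ∧I : Holds v A → Holds v B → Holds v (A ∧' B)
  ∧I a b = ~I (λ h → ~E (⇒E h a) b)

  ∧E₁ : Holds v (A ∧' B) → Holds v A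
  ∧E₁ {A} h with holds? A
  ... | yes a = a
  ... | no ¬a = ⊥-elim (~E h (⇒I (⊥-elim ∘ ¬a)))

  ∧E₂ : Holds v (A ∧' B) → Holds v B
  ∧E₂ {B = B} h with holds? B
  ... | yes b = b
  ... | no ¬b = ⊥-elim (~E h (⇒I (const (~I ¬b))))

  ∨I₁ : Holds v A → Holds v (A ∨' B)
  ∨I₁ a = ⇒I (λ ¬a → ⊥-elim (~E ¬a a))

  ∨I₂ : Holds v B → Holds v (A ∨' B)
  ∨I₂ b = ⇒I (const b)

  ∨E : Holds v (A ∨' B) → Holds v A ⊎ Holds v B
  ∨E {A} h with holds? A
  ... | yes a = inj₁ a
  ... | no ¬a = inj₂ (⇒E h (~I ¬a))

  ⋀I : All (Holds v) As → Holds v (⋀ As)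
  ⋀I []       = ⊤I
  ⋀I (a ∷ as) = ∧I a (⋀I as)

  ⋀E : Holds v (⋀ As) → All (Holds v) As
  ⋀E {[]}    _ = []
  ⋀E {_ ∷ _} h = ∧E₁ h ∷ ⋀E (∧E₂ h)

⋁ : List Fm → Fm
⋁ []       = ⊥'
⋁ (A ∷ As) = A ∨' ⋁ As

⋀~-or-⋁ : ∀ {v} As → Holds v (⋀ (map ~_ As)) ⊎ Holds v (⋁ As)
⋀~-or-⋁ [] = inj₁ ⊤I
⋀~-or-⋁ (A ∷ As) with holds? A | ⋀~-or-⋁ As
... | yes a | _      = inj₂ (∨I₁ a)
... | no ¬a | inj₁ h = inj₁ (∧I (~I ¬a) h)
... | no _  | inj₂ h = inj₂ (∨I₂ h)

⊢-taut : All ILW*⊢_ Ts → (∀ v → All (Holds v) Ts → Holds v B) → ILW*⊢ B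
⊢-taut []       f = taut (λ v → holds (f v []))
⊢-taut (t ∷ ts) f = mp (⊢-taut ts (λ v hs → ⇒I (λ a → f v (a ∷ hs)))) t

_∪[_] : FmSet → Fm → FmSet
(X ∪[ B ]) A = X A ⊎ A ≡ B

split-∪ : All (X ∪[ B ]) Bs →
          Σ (List Fm) λ Cs → All X Cs × (∀ v → Holds v B → All (Holds v) Cs → All (Holds v) Bs)
split-∪ [] = [] , [] , λ _ _ _ → []
split-∪ (inj₁ x ∷ xs) with split-∪ xs
... | Cs , cs , f = _ ∷ Cs , x ∷ cs , λ { v b (c ∷ hs) → c ∷ f v b hs }
split-∪ (inj₂ refl ∷ xs) with split-∪ xs
... | Cs , cs , f = Cs , cs , λ v b hs → b ∷ f v b hs

mcs-closed : MaxCons X → All X As → ILW*⊢ (⋀ As ⇒ B) → X B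
mcs-closed {X} {As} {B} (con , max) as ⊢B = max (X ∪[ B ]) (λ _ → inj₁) con∪ B (inj₂ refl)
  where
  con∪ : Consistent (X ∪[ B ])
  con∪ (Bs , bs , ⊢¬Bs) with split-∪ bs
  ... | Cs , cs , f = con (As ++ Cs , ++⁺ as cs , ⊢-taut (⊢B ∷ ⊢¬Bs ∷ [])
    λ { v (hB ∷ h¬Bs ∷ []) → ⇒I λ h →
          let hs = ⋀E h
              b  = ⇒E hB (⋀I (++⁻ˡ As hs))
          in ⇒E h¬Bs (⋀I (f v b (++⁻ʳ As hs))) })

mcs-taut : MaxCons X → All ILW*⊢_ Ts → All X As →
           (∀ v → All (Holds v) Ts → All (Holds v) As → Holds v B) → X B
mcs-taut m ts as f = mcs-closed m as (⊢-taut ts λ v hs → ⇒I (f v hs ∘ ⋀E))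

mcs-thm : MaxCons X → ILW*⊢ A → X A
mcs-thm m ⊢A = mcs-taut m (⊢A ∷ []) [] λ { v (a ∷ []) [] → a }

mcs-∧⁻ : MaxCons X → X (A ∧' B) → X A × X B
mcs-∧⁻ m ab = mcs-taut m [] (ab ∷ []) (λ { v [] (h ∷ []) → ∧E₁ h })
            , mcs-taut m [] (ab ∷ []) (λ { v [] (h ∷ []) → ∧E₂ h })

mcs-unsat : MaxCons X → All X As → (∀ v → ¬ All (Holds v) As) → ⊥
mcs-unsat {As = As} (con , _) as f = con (As , as , ⊢-taut [] λ v _ → ⇒I (⊥-elim ∘ f v ∘ ⋀E))

formulas : ℕ → List Fm
formulas zero    = ⊥' ∷ []
formulas (suc m) = formulas m ++ var m ∷ map □ (formulas m)
  ++ cartesianProductWith _⇒_ (formulas m) (formulas m)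
  ++ cartesianProductWith _▷_ (formulas m) (formulas m)

formulas-mono′ : ∀ {m m′} → m ≤′ m′ → A ∈ formulas m → A ∈ formulas m′
formulas-mono′ ≤′-refl      p = p
formulas-mono′ (≤′-step le) p = ∈-++⁺ˡ (formulas-mono′ le p)

formulas-mono : ∀ {m m′} → m ≤ m′ → A ∈ formulas m → A ∈ formulas m′
formulas-mono = formulas-mono′ ∘ ≤⇒≤′

formulas-∈-binary : ∀ (_∙_ : Fm → Fm → Fm) a b → A ∈ formulas a → B ∈ formulas b →
                    (A ∙ B) ∈ cartesianProductWith _∙_ (formulas (a ⊔ b)) (formulas (a ⊔ b))
formulas-∈-binary _∙_ a b p q =
  ∈-cartesianProductWith⁺ _∙_ (formulas-mono (m≤m⊔n a b) p) (formulas-mono (m≤n⊔m a b) q)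

formulas-complete : ∀ A → ∃ λ m → A ∈ formulas m
formulas-complete ⊥'      = 0 , here refl
formulas-complete (var p) = suc p , ∈-++⁺ʳ (formulas p) (here refl)
formulas-complete (□ A) with formulas-complete A
... | a , p = suc a , ∈-++⁺ʳ (formulas a) (there (∈-++⁺ˡ (∈-map⁺ □ p)))
formulas-complete (A ⇒ B) with formulas-complete A | formulas-complete B
... | a , p | b , q = suc (a ⊔ b) , ∈-++⁺ʳ (formulas (a ⊔ b)) (there (∈-++⁺ʳ (map □ (formulas (a ⊔ b)))
  (∈-++⁺ˡ (formulas-∈-binary _⇒_ a b p q))))
formulas-complete (A ▷ B) with formulas-complete A | formulas-complete B
... | a , p | b , q = suc (a ⊔ b) , ∈-++⁺ʳ (formulas (a ⊔ b)) (there (∈-++⁺ʳ (map □ (formulas (a ⊔ b)))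
  (∈-++⁺ʳ (cartesianProductWith _⇒_ (formulas (a ⊔ b)) (formulas (a ⊔ b)))
    (formulas-∈-binary _▷_ a b p q))))

consistent-⊆ : X ⊆ Y → Consistent Y → Consistent X
consistent-⊆ X⊆Y con (As , as , ⊢¬As) = con (As , All.map (X⊆Y _) as , ⊢¬As)

insert : (X : FmSet) (A : Fm) → Dec (Consistent (X ∪[ A ])) → FmSet
insert X A (yes _) = X ∪[ A ]
insert X A (no _)  = X

insert-⊇ : ∀ d → X ⊆ insert X A d
insert-⊇ (yes _) _ x = inj₁ x
insert-⊇ (no _)  _ x = x

insert-consistent : Consistent X → ∀ d → Consistent (insert X A d)
insert-consistent _   (yes con) = con
insert-consistent con (no _)    = con

insert-∋ : ∀ d → X ⊆ Y → Consistent Y → Y A → insert X A d A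
insert-∋ (yes _) _ _ _ = inj₂ refl
insert-∋ {X} {Y} {A} (no ¬con) X⊆Y con y = ⊥-elim (¬con (consistent-⊆ X∪A⊆Y con))
  where
  X∪A⊆Y : (X ∪[ A ]) ⊆ Y
  X∪A⊆Y B (inj₁ x)    = X⊆Y B x
  X∪A⊆Y B (inj₂ refl) = y

module _ (em : ExcludedMiddle 0ℓ) where

  insertAll : FmSet → List Fm → FmSet
  insertAll X []       = X
  insertAll X (A ∷ As) = insertAll (insert X A em) As

  insertAll-⊇ : ∀ As → X ⊆ insertAll X As
  insertAll-⊇ []       _ x = x
  insertAll-⊇ (A ∷ As) B x = insertAll-⊇ As B (insert-⊇ em B x)

  insertAll-consistent : ∀ As → Consistent X → Consistent (insertAll X As)
  insertAll-consistent []       con = con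
  insertAll-consistent (A ∷ As) con = insertAll-consistent As (insert-consistent con em)

  insertAll-∋ : ∀ X As → A ∈ As → insertAll X As ⊆ Y → Consistent Y → Y A → insertAll X As A
  insertAll-∋ X (B ∷ As) (there p) ⊆Y con y = insertAll-∋ (insert X B em) As p ⊆Y con y
  insertAll-∋ X (A ∷ As) (here refl) ⊆Y con y = insertAll-⊇ As A
    (insert-∋ em (λ B x → ⊆Y B (insertAll-⊇ As B (insert-⊇ em B x))) con y)

  module _ (X : FmSet) where

    stage : ℕ → FmSet
    stage zero    = X
    stage (suc m) = insertAll (stage m) (formulas m)

    stage-mono : ∀ {m m′} → m ≤′ m′ → stage m ⊆ stage m′
    stage-mono ≤′-refl                _ x = x
    stage-mono (≤′-step {m′} m≤m′) B x = insertAll-⊇ (formulas m′) B (stage-mono m≤m′ B x)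

    stage-consistent : Consistent X → ∀ m → Consistent (stage m)
    stage-consistent con zero    = con
    stage-consistent con (suc m) = insertAll-consistent (formulas m) (stage-consistent con m)

    ⋃stage : FmSet
    ⋃stage A = ∃ λ m → stage m A

    ⋃stage-finite : All ⋃stage As → ∃ λ m → All (stage m) As
    ⋃stage-finite [] = 0 , []
    ⋃stage-finite ((a , x) ∷ xs) with ⋃stage-finite xs
    ... | b , ys = a ⊔ b , stage-mono (≤⇒≤′ (m≤m⊔n a b)) _ x
                         ∷ All.map (stage-mono (≤⇒≤′ (m≤n⊔m a b)) _) ys

    lindenbaum : Consistent X → MaxCons ⋃stage × X ⊆ ⋃stage
    lindenbaum con = (consistent , maximal) , λ _ x → 0 , x
      where
      consistent : Consistent ⋃stage
      consistent (As , as , ⊢¬As) with ⋃stage-finite as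
      ... | m , ms = stage-consistent con m (As , ms , ⊢¬As)

      maximal : (Y : FmSet) → ⋃stage ⊆ Y → Consistent Y → Y ⊆ ⋃stage
      maximal Y ⊆Y conY A y with formulas-complete A
      ... | m , p = suc m , insertAll-∋ (stage m) (formulas m) p (λ B x → ⊆Y B (suc m , x)) conY y

⊢□-mono : ILW*⊢ (A ⇒ B) → ILW*⊢ (□ A ⇒ □ B)
⊢□-mono ⊢A⇒B = mp K (nec ⊢A⇒B)

mcs-□⊤ : MaxCons X → X (□ ⊤')
mcs-□⊤ m = mcs-thm m (nec (⊢-taut [] λ _ _ → ⊤I))

mcs-□∧ : MaxCons X → X (□ A) → X (□ B) → X (□ (A ∧' B))
mcs-□∧ m a b = mcs-taut m (nec (⊢-taut [] λ _ _ → ⇒I λ x → ⇒I λ y → ∧I x y) ∷ K ∷ K ∷ []) (a ∷ b ∷ [])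
  λ { v (n ∷ k₁ ∷ k₂ ∷ []) (x ∷ y ∷ []) → ⇒E (⇒E k₂ (⇒E (⇒E k₁ n) x)) y }

module ▷-Reasoning {X : FmSet} (m : MaxCons X) where

  ▷-taut : All ILW*⊢_ Ts → (∀ v → All (Holds v) Ts → Holds v A → Holds v B) → X (A ▷ B)
  ▷-taut ts f = mcs-thm m (mp J1 (nec (⊢-taut ts λ v hs → ⇒I (f v hs))))

  ▷-by : (∀ v → Holds v A → Holds v B) → X (A ▷ B)
  ▷-by f = ▷-taut [] λ v _ → f v

  ▷-refl : X (A ▷ A)
  ▷-refl = ▷-by λ _ a → a

  ▷-trans : X (A ▷ B) → X (B ▷ D) → X (A ▷ D)
  ▷-trans ab bd = mcs-taut m (J2 ∷ []) (ab ∷ bd ∷ []) λ { v (j ∷ []) (x ∷ y ∷ []) → ⇒E j (∧I x y) }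

  ▷-∨ : X (A ▷ D) → X (B ▷ D) → X ((A ∨' B) ▷ D)
  ▷-∨ ad bd = mcs-taut m (J3 ∷ []) (ad ∷ bd ∷ []) λ { v (j ∷ []) (x ∷ y ∷ []) → ⇒E j (∧I x y) }

  ▷-⋁ : All (λ A → X (A ▷ B)) As → X (⋁ As ▷ B)
  ▷-⋁ []       = ▷-by λ _ → ⊥-elim ∘ ⊥E
  ▷-⋁ (x ∷ xs) = ▷-∨ x (▷-⋁ xs)

  ◇▷ : X (◇ A ▷ A)
  ◇▷ = mcs-thm m J5

  ▷-W* : X (A ▷ B) → X ((B ∧' □ D) ▷ ((B ∧' □ D) ∧' □ (~ A)))
  ▷-W* ab = mcs-taut m (W* ∷ []) (ab ∷ []) λ { v (w ∷ []) (x ∷ []) → ⇒E w x }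

module Critical {Γ Δ : FmSet} {C P : Fm} (mΓ : MaxCons Γ) (mΔ : MaxCons Δ) where
  open ▷-Reasoning mΓ

  record Admissible (Θ : FmSet) : Set₁ where
    field
      maxCons    : MaxCons Θ
      critical   : Γ ≺[ C ] Θ
      inherits-□ : Δ ⊆□ Θ
      □~P        : Θ (□ (~ P))

  Blocked : Fm → Set
  Blocked F = ∃ λ D → Δ (□ D) × Γ (((F ∧' □ D) ∧' □ (~ P)) ▷ C)

  blocked-⊥ : Blocked ⊥'
  blocked-⊥ = ⊤' , mcs-□⊤ mΔ , ▷-by λ _ h → ⊥-elim (⊥E (∧E₁ (∧E₁ h)))

  blocked-∨ : Blocked F → Blocked G → Blocked (F ∨' G)
  blocked-∨ {F} {G} (D₁ , □D₁ , F▷C) (D₂ , □D₂ , G▷C) =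
    D₁ ∧' D₂ , mcs-□∧ mΔ □D₁ □D₂ , ▷-trans distribute (▷-∨ F▷C G▷C)
    where
    distribute : Γ ((((F ∨' G) ∧' □ (D₁ ∧' D₂)) ∧' □ (~ P)) ▷
                    (((F ∧' □ D₁) ∧' □ (~ P)) ∨' ((G ∧' □ D₂) ∧' □ (~ P))))
    distribute = ▷-taut (⊢□-mono (⊢-taut [] λ _ _ → ⇒I ∧E₁) ∷ ⊢□-mono (⊢-taut [] λ _ _ → ⇒I ∧E₂) ∷ [])
      λ { v (π₁ ∷ π₂ ∷ []) h →
          let □D = ∧E₂ (∧E₁ h) ; □~P = ∧E₂ h in
          [ (λ f → ∨I₁ (∧I (∧I f (⇒E π₁ □D)) □~P))
          , (λ g → ∨I₂ (∧I (∧I g (⇒E π₂ □D)) □~P)) ]′ (∨E (∧E₁ (∧E₁ h))) }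

  module _ (F : Fm) where

    core : Fm → Fm → Fm
    core D G = ((F ∧' □ D) ∧' □ (~ P)) ∧' ((~ G) ∧' □ (~ G))

    -- The set generated by F, □ ~P, the boxed formulas of Δ and ~ G, □ ~ G for G ▷ C ∈ Γ,
    -- presented so that finitely many generators always share a single core.
    Generated : FmSet
    Generated A = ∃ λ D → ∃ λ G → Δ (□ D) × Γ (G ▷ C) × ILW*⊢ (core D G ⇒ A)

    core-antitone : ∀ {D′ G′} → ILW*⊢ (D′ ⇒ D) → ILW*⊢ (G ⇒ G′) → ILW*⊢ (core D′ G′ ⇒ core D G)
    core-antitone ⊢D ⊢G = ⊢-taut (⊢□-mono ⊢D ∷ ⊢G ∷ ⊢□-mono (⊢-taut (⊢G ∷ []) contrapose) ∷ [])
      λ { v (□D ∷ g ∷ □~G ∷ []) → ⇒I λ h →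
          let base = ∧E₁ h ; ~G′ = ∧E₁ (∧E₂ h) ; □~G′ = ∧E₂ (∧E₂ h) in
          ∧I (∧I (∧I (∧E₁ (∧E₁ base)) (⇒E □D (∧E₂ (∧E₁ base)))) (∧E₂ base))
             (∧I (~I (~E ~G′ ∘ ⇒E g)) (⇒E □~G (□~G′))) }
      where
      contrapose : ∀ {A B} v → All (Holds v) ((A ⇒ B) ∷ []) → Holds v (~ B ⇒ ~ A)
      contrapose v (g ∷ []) = ⇒I λ ~G′ → ~I (~E ~G′ ∘ ⇒E g)

    generated-⋀ : All Generated As → Generated (⋀ As)
    generated-⋀ [] = ⊤' , ⊥' , mcs-□⊤ mΔ , ▷-by (λ _ → ⊥-elim ∘ ⊥E) , ⊢-taut [] λ _ _ → ⇒I (const ⊤I)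
    generated-⋀ ((D , G , □D , G▷C , ⊢A) ∷ gs) with generated-⋀ gs
    ... | D′ , G′ , □D′ , G′▷C , ⊢As =
      D ∧' D′ , G ∨' G′ , mcs-□∧ mΔ □D □D′ , ▷-∨ G▷C G′▷C ,
      ⊢-taut (⊢A ∷ ⊢As ∷ core-antitone (⊢-taut [] λ _ _ → ⇒I ∧E₁) (⊢-taut [] λ _ _ → ⇒I ∨I₁)
                     ∷ core-antitone (⊢-taut [] λ _ _ → ⇒I ∧E₂) (⊢-taut [] λ _ _ → ⇒I ∨I₂) ∷ [])
        λ { v (a ∷ as ∷ c₁ ∷ c₂ ∷ []) → ⇒I λ h → ∧I (⇒E a (⇒E c₁ h)) (⇒E as (⇒E c₂ h)) }

    generated-⊥-blocked : Generated ⊥' → Blocked F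
    generated-⊥-blocked (D , G , □D , G▷C , ⊢¬core) =
      D , □D , ▷-trans (▷-taut (⊢¬core ∷ []) G-or-◇G) (▷-trans (▷-∨ ▷-refl ◇▷) G▷C)
      where
      G-or-◇G : ∀ v → All (Holds v) ((core D G ⇒ ⊥') ∷ []) →
                Holds v ((F ∧' □ D) ∧' □ (~ P)) → Holds v (G ∨' ◇ G)
      G-or-◇G v (¬core ∷ []) h with holds? G
      ... | yes g = ∨I₁ g
      ... | no ¬g = ∨I₂ (~I λ □~G → ⊥E (⇒E ¬core (∧I h (∧I (~I ¬g) □~G))))

    extension : ExcludedMiddle 0ℓ → ¬ Blocked F → ∃ λ Θ → Admissible Θ × Θ F
    extension em ¬blocked =
      ⋃stage em Generated , admissible , ∈Θ ⊤' ⊥' (mcs-□⊤ mΔ) ⊥▷C λ _ → ∧E₁ ∘ ∧E₁ ∘ ∧E₁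
      where
      ⊥▷C : Γ (⊥' ▷ C)
      ⊥▷C = ▷-by λ _ → ⊥-elim ∘ ⊥E

      consistent : Consistent Generated
      consistent (As , gs , ⊢¬As) with generated-⋀ gs
      ... | D , G , □D , G▷C , ⊢As = ¬blocked (generated-⊥-blocked
        (D , G , □D , G▷C , ⊢-taut (⊢As ∷ ⊢¬As ∷ []) λ { v (x ∷ y ∷ []) → ⇒I (⇒E y ∘ ⇒E x) }))

      lind : MaxCons (⋃stage em Generated) × Generated ⊆ ⋃stage em Generated
      lind = lindenbaum em Generated consistent

      ∈Θ : ∀ D G → Δ (□ D) → Γ (G ▷ C) → (∀ v → Holds v (core D G) → Holds v A) → ⋃stage em Generated A
      ∈Θ D G □D G▷C f = proj₂ lind _ (D , G , □D , G▷C , ⊢-taut [] λ v _ → ⇒I (f v))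

      admissible : Admissible (⋃stage em Generated)
      admissible = record
        { maxCons    = proj₁ lind
        ; critical   = λ E E▷C → ∈Θ ⊤' E (mcs-□⊤ mΔ) E▷C (λ _ → ∧E₁ ∘ ∧E₂)
                               , ∈Θ ⊤' E (mcs-□⊤ mΔ) E▷C (λ _ → ∧E₂ ∘ ∧E₂)
        ; inherits-□ = λ D □D → ∈Θ D ⊥' □D ⊥▷C λ _ → ∧E₂ ∘ ∧E₁ ∘ ∧E₁
        ; □~P        = ∈Θ ⊤' ⊥' (mcs-□⊤ mΔ) ⊥▷C λ _ → ∧E₂ ∘ ∧E₁
        }

  ▷-unblocked : Γ ≺[ C ] Δ → Δ (◇ P) → Γ (P ▷ W) → ¬ Blocked W
  ▷-unblocked {W} Γ≺Δ ◇P P▷W (D , □D , W▷C) =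
    mcs-unsat mΔ (proj₁ (Γ≺Δ _ Π▷C) ∷ ◇P ∷ □D ∷ []) λ { v (~Π ∷ p ∷ d ∷ []) → ~E ~Π (∧I p d) }
    where
    Π : Fm
    Π = ◇ P ∧' □ D

    -- W* for P ▷ W ∨ Π; the disjunct Π is then discarded, as ◇ P contradicts □ ~ P.
    Π▷C : Γ (Π ▷ C)
    Π▷C = ▷-trans (▷-by λ _ x → ∧I (∨I₂ x) (∧E₂ x))
          (▷-trans (▷-W* (▷-trans P▷W (▷-by λ _ → ∨I₁)))
          (▷-trans (▷-by λ _ h → [ (λ w → ∧I (∧I w (∧E₂ (∧E₁ h))) (∧E₂ h))
                                 , (λ x → ⊥-elim (~E (∧E₁ x) (∧E₂ h))) ]′ (∨E (∧E₁ (∧E₁ h))))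
           W▷C))

  module Saturation {n} (S T : Fin n → Fm) (S▷T : ∀ j → Γ (S j ▷ T j)) where

    avoiding : List (Fin n) → Fm
    avoiding R = ⋀ (map ~_ (map S R))

    avoiding-∉ : ∀ {R j} → MaxCons X → X (avoiding R) → X (S j) → j ∉ R
    avoiding-∉ m avoid s j∈R = mcs-unsat m (s ∷ avoid ∷ [])
      λ { v (sj ∷ av ∷ []) → ~E (All.lookup (map⁻ (map⁻ (⋀E av))) j∈R) sj }

    data BlockedChain : List (Fin n) → Set where
      []  : BlockedChain []
      _∷_ : ∀ {j R} → Blocked (T j ∧' avoiding R) → BlockedChain R → BlockedChain (j ∷ R)

    discarded : List (Fin n) → Fm
    discarded []      = ⊥'
    discarded (j ∷ R) = (T j ∧' avoiding R) ∨' discarded R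

    discarded-blocked : ∀ {R} → BlockedChain R → Blocked (discarded R)
    discarded-blocked []      = blocked-⊥
    discarded-blocked (b ∷ c) = blocked-∨ b (discarded-blocked c)

    S▷discarded : ∀ {R} → BlockedChain R → All (λ A → Γ (A ▷ discarded R)) (map S R)

    ▷-refine : ∀ {R} → BlockedChain R → Γ (A ▷ B) → Γ (A ▷ ((B ∧' avoiding R) ∨' discarded R))
    ▷-refine {B = B} {R} c A▷B =
      ▷-trans A▷B (▷-trans (▷-by split)
        (▷-∨ (▷-by λ _ → ∨I₁) (▷-trans (▷-⋁ (S▷discarded c)) (▷-by λ _ → ∨I₂))))
      where
      split : ∀ v → Holds v B → Holds v ((B ∧' avoiding R) ∨' ⋁ (map S R))
      split v b = [ ∨I₁ ∘ ∧I b , ∨I₂ ]′ (⋀~-or-⋁ (map S R))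

    S▷discarded []                = []
    S▷discarded {j ∷ R} (_ ∷ c) =
      ▷-refine c (S▷T j) ∷ All.map (λ A▷d → ▷-trans A▷d (▷-by λ _ → ∨I₂)) (S▷discarded c)

    Saturated : List (Fin n) → Set
    Saturated R = ∀ j → j ∈ R ⊎ ¬ Blocked (T j ∧' avoiding R)

    saturate : ExcludedMiddle 0ℓ → ∀ {k R} (pending : Vec (Fin n) k) → BlockedChain R →
               (∀ j → j ∈ R ⊎ j ∈ᵥ pending) → ∃ λ R′ → BlockedChain R′ × Saturated R′
    saturate em []ᵥ c cover = _ , c , λ j → [ inj₁ , (λ ()) ]′ (cover j)
    saturate em {R = R} pending@(_ ∷ᵥ _) c cover
      with em {∃ λ j → j ∈ᵥ pending × Blocked (T j ∧' avoiding R)}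
    ... | no none = R , c , λ j → [ inj₁ , (λ p → inj₂ λ b → none (j , p , b)) ]′ (cover j)
    ... | yes (j , p , b) with ∈ᵥ-remove p
    ...   | rest , split = saturate em rest (b ∷ c) λ i → [ inj₁ ∘ there , cover′ ]′ (cover i)
      where
      cover′ : ∀ {i} → i ∈ᵥ pending → i ∈ j ∷ R ⊎ i ∈ᵥ rest
      cover′ q = [ inj₁ ∘ here , inj₂ ]′ (split q)

    module Family (em : ExcludedMiddle 0ℓ) {R} (saturated : Saturated R)
                  {F₀} (¬blocked : ¬ Blocked (F₀ ∧' avoiding R)) where

      target : Fin (suc n) → ∃ λ F → ¬ Blocked (F ∧' avoiding R)
      target zero    = F₀ , ¬blocked
      target (suc j) = [ const (F₀ , ¬blocked) , (λ ¬b → T j , ¬b) ]′ (saturated j)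

      target-T : ∀ j → j ∉ R → proj₁ (target (suc j)) ≡ T j
      target-T j j∉R with saturated j
      ... | inj₁ j∈R = ⊥-elim (j∉R j∈R)
      ... | inj₂ _   = refl

      extended : ∀ i → ∃ λ Θ → Admissible Θ × Θ (proj₁ (target i) ∧' avoiding R)
      extended i = extension _ em (proj₂ (target i))

      family : Fin (suc n) → FmSet
      family = proj₁ ∘ extended

      family-admissible : ∀ i → Admissible (family i)
      family-admissible = proj₁ ∘ proj₂ ∘ extended

      family-∋ : ∀ i → family i (proj₁ (target i)) × family i (avoiding R)
      family-∋ i = mcs-∧⁻ (Admissible.maxCons (family-admissible i)) (proj₂ (proj₂ (extended i)))

      family-T : ∀ j h → family h (S j) → family (suc j) (T j)
      family-T j h s = subst (family (suc j)) (target-T j j∉R) (proj₁ (family-∋ (suc j)))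
        where
        j∉R : j ∉ R
        j∉R = avoiding-∉ (Admissible.maxCons (family-admissible h)) (proj₂ (family-∋ h)) s

    record AdmissibleFamily (Q : Fm) : Set₁ where
      field
        Δs         : Fin (suc n) → FmSet
        admissible : ∀ i → Admissible (Δs i)
        Δs₀∋Q      : Δs zero Q
        S⇒T        : ∀ j h → Δs h (S j) → Δs (suc j) (T j)

    admissible-family : ∀ {Q} → ExcludedMiddle 0ℓ → Γ ≺[ C ] Δ → Δ (◇ P) → Γ (P ▷ Q) →
                        AdmissibleFamily Q
    admissible-family {Q} em Γ≺Δ ◇P P▷Q with saturate em (allFin n) [] (inj₂ ∘ ∈-allFin⁺)
    ... | R , chain , saturated = record
      { Δs = family ; admissible = family-admissible
      ; Δs₀∋Q = proj₁ (family-∋ zero) ; S⇒T = family-T }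
      where
      Q-unblocked : ¬ Blocked (Q ∧' avoiding R)
      Q-unblocked b = ▷-unblocked Γ≺Δ ◇P (▷-refine chain P▷Q) (blocked-∨ b (discarded-blocked chain))

      open Family em saturated Q-unblocked

lemma7p11 : ExcludedMiddle 0ℓ →
    (Γ Δ : FmSet) (C P Q : Fm) (n : ℕ) (S T : Fin n → Fm) →
    MaxCons Γ → MaxCons Δ → Γ ≺[ C ] Δ →
    Γ (P ▷ Q) → (∀ j → Γ (S j ▷ T j)) → Δ (◇ P) →
    Σ ℕ λ k → k ≤ n × Σ (Fin (suc k) → FmSet) λ Δs →
    (∀ i → MaxCons (Δs i)) ×
    (∀ i → Γ ≺[ C ] Δs i) ×
    (∀ i → Δ ⊆□ Δs i) ×
    Δs zero Q ×
    (∀ i → Δs i (□ (~ P))) ×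
    (∀ j h → Δs h (S j) → ∃ λ i → Δs i (T j))
lemma7p11 em Γ Δ C P Q n S T mΓ mΔ Γ≺Δ P▷Q S▷T ◇P =
  n , ≤-refl , Δs , maxCons ∘ admissible , critical ∘ admissible , inherits-□ ∘ admissible ,
  Δs₀∋Q , □~P ∘ admissible , λ j h s → suc j , S⇒T j h s
  where
  open Critical {C = C} {P = P} mΓ mΔ
  open Admissible
  open Saturation S T S▷T
  open AdmissibleFamily (admissible-family em Γ≺Δ ◇P P▷Q)
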